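{- Let $\Sigma$ be a finite alphabet, $k\ge 1$, and let $S_X,S_Y\subseteq\Sigma^k$ be finite sets of $k$-mers. With $M_j$ and $F_i(X,Y)$ as defined below, for every $0\le i\le k$, $$M_i=F_i(X,Y)-\sum_{j=0}^{i-1}\binom{k-j}{k-i}M_j.$$
   Context: $d(\cdot,\cdot)$ is Hamming distance on $\Sigma^k$. $M_j=|\{(\alpha,\beta)\in S_X\times S_Y: d(\alpha,\beta)=j\}|$. $\mathcal{Q}_k(j)$ is the set of all $j$-element subsets of $\{1,\ldots,k\}$; for $\theta\in\mathcal{Q}_k(j)$ and a $k$-mer $\alpha$, $\alpha|_\theta$ is the $j$-mer of characters of $\alpha$ at the indices in $\theta$. $f_\theta(X,Y)=|\{(\alpha,\beta)\in S_X\times S_Y:\alpha|_\theta=\beta|_\theta\}|$ and $F_i(X,Y)=\sum_{\theta\in\mathcal{Q}_k(k-i)}f_\theta(X,Y)$. -}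

module Defs where

open import Data.Nat using (ℕ; zero; suc; _+_; _*_; _∸_)
open import Data.Nat.Combinatorics using (_C_)
open import Data.Nat.ListAction using (sum)
open import Data.Bool using (Bool; true; false)
open import Data.Fin using (Fin)
import Data.Fin.Properties as FinP
open import Data.Fin.Subset using (Subset; ∣_∣; outside; inside)
open import Data.Vec using (Vec; []; _∷_)
open import Data.List using (List; []; _∷_; length; filter; map; cartesianProduct; concatMap; upTo)
import Data.List.Properties as ListP
open import Data.Product using (_×_; _,_; proj₁; proj₂)
open import Relation.Binary.PropositionalEquality using (_≡_)
open import Relation.Nullary using (¬_)
import Data.Nat.Properties as NatP
open import Relation.Nullary.Decidable using (¬?)

KMer : ℕ → ℕ → Set
KMer s k = Vec (Fin s) k

hamming : ∀ {s k} → KMer s k → KMer s k → ℕ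
hamming []       []       = 0
hamming (a ∷ α) (b ∷ β) with a FinP.≟ b
... | Relation.Nullary.yes _ = hamming α β
... | Relation.Nullary.no  _ = suc (hamming α β)

allSubsets : (k : ℕ) → List (Subset k)
allSubsets zero    = [] ∷ []
allSubsets (suc k) = map (outside ∷_) (allSubsets k) Data.List.++ map (inside ∷_) (allSubsets k)

Q : (k j : ℕ) → List (Subset k)
Q k j = filter (λ θ → ∣ θ ∣ NatP.≟ j) (allSubsets k)

restrict : ∀ {A : Set} {k} → Subset k → Vec A k → List A
restrict []            []      = []
restrict (true  ∷ θ) (a ∷ α) = a ∷ restrict θ α
restrict (false ∷ θ) (a ∷ α) = restrict θ α

-- All pairs (α, β) ∈ S_X × S_Y (sets given as duplicate-free lists).
pairs : ∀ {s k} → List (KMer s k) → List (KMer s k) → List (KMer s k × KMer s k)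
pairs SX SY = cartesianProduct SX SY

M : ∀ {s k} → List (KMer s k) → List (KMer s k) → ℕ → ℕ
M SX SY j = length (filter (λ p → hamming (proj₁ p) (proj₂ p) NatP.≟ j) (pairs SX SY))

f : ∀ {s k} → Subset k → List (KMer s k) → List (KMer s k) → ℕ
f θ SX SY = length (filter (λ p → ListP.≡-dec FinP._≟_ (restrict θ (proj₁ p)) (restrict θ (proj₂ p))) (pairs SX SY))

F : ∀ {s k} → ℕ → List (KMer s k) → List (KMer s k) → ℕ
F {k = k} i SX SY = sum (map (λ θ → f θ SX SY) (Q k (k ∸ i)))

correction : ∀ {s k} → List (KMer s k) → List (KMer s k) → ℕ → ℕ
correction {k = k} SX SY i = sum (map (λ j → ((k ∸ j) C (k ∸ i)) * M SX SY j) (upTo i))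

-- Both sides equal the sum over pairs (α, β) of C(k − d(α,β), k − i).
-- For F_i, the (k − i)-sets θ with α|θ = β|θ are the (k − i)-subsets of the
-- k − d(α,β) positions where α and β agree (counted by induction on k via
-- Pascal's rule). On the left, a pair at distance d contributes
-- [d = i] + Σ_{j<i} C(k − j, k − i) [d = j], which is C(k − d, k − i) in each of
-- the cases d < i, d = i and d > i (where the binomial coefficient vanishes).
module Submission where

open import Defs
open import Data.Nat using (ℕ; zero; suc; _+_; _*_; _∸_; _≤_; _<_; _≥_; z≤n; s≤s; s≤s⁻¹)
open import Data.Nat.Properties
open import Data.Nat.Combinatorics using (_C_; nCn≡1; nCk+nC[k+1]≡[n+1]C[k+1]; k>n⇒nCk≡0)
open import Data.Nat.ListAction using (sum)
open import Data.Nat.ListAction.Properties using (sum-++)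
open import Algebra.Properties.CommutativeSemigroup +-commutativeSemigroup using (interchange)
open import Data.Bool using (Bool; true; false)
import Data.Fin.Properties as FinP
open import Data.Fin.Subset using (Subset; ∣_∣; outside; inside)
open import Data.Fin using (Fin)
open import Data.Vec using ([]; _∷_)
open import Data.List using (List; []; _∷_; length; filter; map; upTo; _++_)
import Data.List.Properties as ListP
open import Data.List.Relation.Unary.Unique.Propositional using (Unique)
open import Data.Product using (_×_; proj₁; proj₂; uncurry)
open import Relation.Binary.PropositionalEquality using (_≡_; _≢_; refl; sym; trans; cong; cong₂; module ≡-Reasoning)
open import Relation.Binary.Definitions using (tri<; tri≈; tri>)
open import Relation.Nullary using (does; yes; no; contradiction)
open import Relation.Nullary.Decidable using (dec-true; dec-false)
open import Relation.Unary using (Pred; Decidable)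
open import Level using (0ℓ)

open ≡-Reasoning

indicator : Bool → ℕ
indicator true  = 1
indicator false = 0

private variable
  A B : Set

sum-map-zero : (xs : List A) → sum (map (λ _ → 0) xs) ≡ 0
sum-map-zero []       = refl
sum-map-zero (_ ∷ xs) = sum-map-zero xs


sum-map-cong : ∀ {g h : A → ℕ} → (∀ x → g x ≡ h x) → ∀ xs → sum (map g xs) ≡ sum (map h xs)
sum-map-cong g≡h []       = refl
sum-map-cong g≡h (x ∷ xs) = cong₂ _+_ (g≡h x) (sum-map-cong g≡h xs)

sum-map-+ : ∀ (g h : A → ℕ) xs → sum (map (λ x → g x + h x) xs) ≡ sum (map g xs) + sum (map h xs)
sum-map-+ g h []       = refl
sum-map-+ g h (x ∷ xs) = trans (cong (g x + h x +_) (sum-map-+ g h xs)) (interchange (g x) (h x) _ _)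

*-distribˡ-sum : ∀ c (g : A → ℕ) xs → c * sum (map g xs) ≡ sum (map (λ x → c * g x) xs)
*-distribˡ-sum c g []       = *-zeroʳ c
*-distribˡ-sum c g (x ∷ xs) = trans (*-distribˡ-+ c (g x) _) (cong (c * g x +_) (*-distribˡ-sum c g xs))

sum-map-++ : ∀ (g : A → ℕ) xs ys → sum (map g (xs ++ ys)) ≡ sum (map g xs) + sum (map g ys)
sum-map-++ g xs ys = trans (cong sum (ListP.map-++ g xs ys)) (sum-++ (map g xs) (map g ys))

sum-map-swap : ∀ (g : A → B → ℕ) xs ys →
  sum (map (λ x → sum (map (g x) ys)) xs) ≡ sum (map (λ y → sum (map (λ x → g x y) xs)) ys)
sum-map-swap g []       ys = sym (sum-map-zero ys)
sum-map-swap g (x ∷ xs) ys = trans (cong (sum (map (g x) ys) +_) (sum-map-swap g xs ys))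
  (sym (sum-map-+ (g x) (λ y → sum (map (λ x → g x y) xs)) ys))

module _ {P : Pred A 0ℓ} (P? : Decidable P) where

  length-filter≡sum-indicator : ∀ xs → length (filter P? xs) ≡ sum (map (λ x → indicator (does (P? x))) xs)
  length-filter≡sum-indicator []       = refl
  length-filter≡sum-indicator (x ∷ xs) with does (P? x)
  ... | true  = cong suc (length-filter≡sum-indicator xs)
  ... | false = length-filter≡sum-indicator xs

  sum-map-filter : ∀ (h : A → ℕ) xs → sum (map h (filter P? xs)) ≡ sum (map (λ x → indicator (does (P? x)) * h x) xs)
  sum-map-filter h []       = refl
  sum-map-filter h (x ∷ xs) with does (P? x)
  ... | true  = cong₂ _+_ (sym (+-identityʳ (h x))) (sum-map-filter h xs)
  ... | false = sum-map-filter h xs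

sum-map-upTo-suc : ∀ (g : ℕ → ℕ) i → sum (map g (upTo (suc i))) ≡ sum (map g (upTo i)) + g i
sum-map-upTo-suc g i = begin
  sum (map g (upTo (suc i)))            ≡⟨ cong (λ l → sum (map g l)) (ListP.upTo-∷ʳ i) ⟨
  sum (map g (upTo i ++ i ∷ []))        ≡⟨ sum-map-++ g (upTo i) (i ∷ []) ⟩
  sum (map g (upTo i)) + (g i + 0)      ≡⟨ cong (sum (map g (upTo i)) +_) (+-identityʳ (g i)) ⟩
  sum (map g (upTo i)) + g i            ∎

δ : ℕ → ℕ → ℕ
δ d j = indicator (does (d ≟ j))

δ-refl : ∀ d → δ d d ≡ 1
δ-refl d = cong indicator (dec-true (d ≟ d) refl)

δ-≢ : ∀ {d j} → d ≢ j → δ d j ≡ 0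
δ-≢ {d} {j} d≢j = cong indicator (dec-false (d ≟ j) d≢j)

sum-upTo-δ-≥ : ∀ (h : ℕ → ℕ) d i → i ≤ d → sum (map (λ j → h j * δ d j) (upTo i)) ≡ 0
sum-upTo-δ-≥ h d zero    _   = refl
sum-upTo-δ-≥ h d (suc i) i<d = begin
  sum (map (λ j → h j * δ d j) (upTo (suc i)))          ≡⟨ sum-map-upTo-suc (λ j → h j * δ d j) i ⟩
  sum (map (λ j → h j * δ d j) (upTo i)) + h i * δ d i  ≡⟨ cong₂ _+_ (sum-upTo-δ-≥ h d i (<⇒≤ i<d)) (cong (h i *_) (δ-≢ (>⇒≢ i<d))) ⟩
  0 + h i * 0                                           ≡⟨ *-zeroʳ (h i) ⟩
  0                                                     ∎

sum-upTo-δ-< : ∀ (h : ℕ → ℕ) d i → d < i → sum (map (λ j → h j * δ d j) (upTo i)) ≡ h d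
sum-upTo-δ-< h d (suc i) d<1+i rewrite sum-map-upTo-suc (λ j → h j * δ d j) i with <-cmp d i
... | tri< d<i d≢i _ = begin
  sum (map (λ j → h j * δ d j) (upTo i)) + h i * δ d i  ≡⟨ cong₂ _+_ (sum-upTo-δ-< h d i d<i) (cong (h i *_) (δ-≢ d≢i)) ⟩
  h d + h i * 0                                         ≡⟨ cong (h d +_) (*-zeroʳ (h i)) ⟩
  h d + 0                                               ≡⟨ +-identityʳ (h d) ⟩
  h d                                                   ∎
... | tri≈ _ refl _ = begin
  sum (map (λ j → h j * δ d j) (upTo d)) + h d * δ d d  ≡⟨ cong₂ _+_ (sum-upTo-δ-≥ h d d ≤-refl) (cong (h d *_) (δ-refl d)) ⟩
  h d * 1                                               ≡⟨ *-identityʳ (h d) ⟩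
  h d                                                   ∎
... | tri> _ _ i<d = contradiction (s≤s⁻¹ d<1+i) (<⇒≱ i<d)

δ+sum-upTo≡binomial : ∀ k d i → d ≤ k →
  δ d i + sum (map (λ j → ((k ∸ j) C (k ∸ i)) * δ d j) (upTo i)) ≡ (k ∸ d) C (k ∸ i)
δ+sum-upTo≡binomial k d i d≤k with <-cmp d i
... | tri< d<i d≢i _ = cong₂ _+_ (δ-≢ d≢i) (sum-upTo-δ-< (λ j → (k ∸ j) C (k ∸ i)) d i d<i)
... | tri≈ _ refl _ = begin
  δ d d + sum (map (λ j → ((k ∸ j) C (k ∸ d)) * δ d j) (upTo d))  ≡⟨ cong₂ _+_ (δ-refl d) (sum-upTo-δ-≥ (λ j → (k ∸ j) C (k ∸ d)) d d ≤-refl) ⟩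
  1                                                              ≡⟨ nCn≡1 (k ∸ d) ⟨
  (k ∸ d) C (k ∸ d)                                              ∎
... | tri> _ d≢i i<d = begin
  δ d i + sum (map (λ j → ((k ∸ j) C (k ∸ i)) * δ d j) (upTo i))  ≡⟨ cong₂ _+_ (δ-≢ d≢i) (sum-upTo-δ-≥ (λ j → (k ∸ j) C (k ∸ i)) d i (<⇒≤ i<d)) ⟩
  0                                                              ≡⟨ k>n⇒nCk≡0 (∸-monoʳ-< i<d d≤k) ⟨
  (k ∸ d) C (k ∸ i)                                              ∎

hamming≤length : ∀ {s k} (α β : KMer s k) → hamming α β ≤ k
hamming≤length []      []      = z≤n
hamming≤length (a ∷ α) (b ∷ β) with a FinP.≟ b
... | yes _ = m≤n⇒m≤1+n (hamming≤length α β)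
... | no  _ = s≤s (hamming≤length α β)

module _ {s : ℕ} where

  agreesOn : ∀ {k} → Subset k → KMer s k → KMer s k → ℕ
  agreesOn θ α β = indicator (does (ListP.≡-dec FinP._≟_ (restrict θ α) (restrict θ β)))

  agreeingSubsets : ∀ k → ℕ → KMer s k → KMer s k → ℕ
  agreeingSubsets k m α β = sum (map (λ θ → indicator (does (∣ θ ∣ ≟ m)) * agreesOn θ α β) (allSubsets k))

  module _ {k} {a b : Fin s} {α β : KMer s k} where

    agreesOn-inside-≡ : a ≡ b → ∀ θ → agreesOn (inside ∷ θ) (a ∷ α) (b ∷ β) ≡ agreesOn θ α β
    agreesOn-inside-≡ a≡b θ with a FinP.≟ b
    ... | yes _   = refl
    ... | no  a≢b = contradiction a≡b a≢b

    agreesOn-inside-≢ : a ≢ b → ∀ θ → agreesOn (inside ∷ θ) (a ∷ α) (b ∷ β) ≡ 0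
    agreesOn-inside-≢ a≢b θ with a FinP.≟ b
    ... | yes a≡b = contradiction a≡b a≢b
    ... | no  _   = refl

    agreeingSubsets-∷ : ∀ m → agreeingSubsets (suc k) m (a ∷ α) (b ∷ β) ≡
      agreeingSubsets k m α β +
      sum (map (λ θ → indicator (does (suc ∣ θ ∣ ≟ m)) * agreesOn (inside ∷ θ) (a ∷ α) (b ∷ β)) (allSubsets k))
    agreeingSubsets-∷ m = trans (sum-map-++ count (map (outside ∷_) (allSubsets k)) (map (inside ∷_) (allSubsets k)))
      (cong₂ _+_ (cong sum (sym (ListP.map-∘ (allSubsets k)))) (cong sum (sym (ListP.map-∘ (allSubsets k)))))
      where
      count : Subset (suc k) → ℕ
      count θ = indicator (does (∣ θ ∣ ≟ m)) * agreesOn θ (a ∷ α) (b ∷ β)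

    agreeingSubsets-∷-≢ : a ≢ b → ∀ m → agreeingSubsets (suc k) m (a ∷ α) (b ∷ β) ≡ agreeingSubsets k m α β
    agreeingSubsets-∷-≢ a≢b m = begin
      agreeingSubsets (suc k) m (a ∷ α) (b ∷ β)
        ≡⟨ agreeingSubsets-∷ m ⟩
      agreeingSubsets k m α β + sum (map (λ θ → indicator (does (suc ∣ θ ∣ ≟ m)) * agreesOn (inside ∷ θ) (a ∷ α) (b ∷ β)) (allSubsets k))
        ≡⟨ cong (agreeingSubsets k m α β +_) (sum-map-cong vanishes (allSubsets k)) ⟩
      agreeingSubsets k m α β + sum (map (λ _ → 0) (allSubsets k))
        ≡⟨ cong (agreeingSubsets k m α β +_) (sum-map-zero (allSubsets k)) ⟩
      agreeingSubsets k m α β + 0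
        ≡⟨ +-identityʳ _ ⟩
      agreeingSubsets k m α β ∎
      where
      vanishes : ∀ θ → indicator (does (suc ∣ θ ∣ ≟ m)) * agreesOn (inside ∷ θ) (a ∷ α) (b ∷ β) ≡ 0
      vanishes θ = trans (cong (indicator (does (suc ∣ θ ∣ ≟ m)) *_) (agreesOn-inside-≢ a≢b θ)) (*-zeroʳ (indicator (does (suc ∣ θ ∣ ≟ m))))

    agreeingSubsets-∷-≡ : a ≡ b → ∀ m →
      agreeingSubsets (suc k) (suc m) (a ∷ α) (b ∷ β) ≡ agreeingSubsets k (suc m) α β + agreeingSubsets k m α β
    agreeingSubsets-∷-≡ a≡b m = trans (agreeingSubsets-∷ (suc m))
      (cong (agreeingSubsets k (suc m) α β +_)
        (sum-map-cong (λ θ → cong (indicator (does (∣ θ ∣ ≟ m)) *_) (agreesOn-inside-≡ a≡b θ)) (allSubsets k)))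

  agreeingSubsets-zero : ∀ k (α β : KMer s k) → agreeingSubsets k 0 α β ≡ 1
  agreeingSubsets-zero zero    []      []      = refl
  agreeingSubsets-zero (suc k) (a ∷ α) (b ∷ β) = begin
    agreeingSubsets (suc k) 0 (a ∷ α) (b ∷ β)
      ≡⟨ agreeingSubsets-∷ {a = a} {b} {α} {β} 0 ⟩
    agreeingSubsets k 0 α β + sum (map (λ _ → 0) (allSubsets k))
      ≡⟨ cong₂ _+_ (agreeingSubsets-zero k α β) (sum-map-zero (allSubsets k)) ⟩
    1 ∎

  agreeingSubsets≡binomial : ∀ k (α β : KMer s k) m → agreeingSubsets k m α β ≡ (k ∸ hamming α β) C m
  agreeingSubsets≡binomial k α β zero = agreeingSubsets-zero k α β
  agreeingSubsets≡binomial zero [] [] (suc m) = refl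
  -- Matching on a ≟ b also unfolds hamming (a ∷ α) (b ∷ β) in the goal.
  agreeingSubsets≡binomial (suc k) (a ∷ α) (b ∷ β) (suc m) with a FinP.≟ b
  ... | no a≢b = begin
    agreeingSubsets (suc k) (suc m) (a ∷ α) (b ∷ β)  ≡⟨ agreeingSubsets-∷-≢ {α = α} {β} a≢b (suc m) ⟩
    agreeingSubsets k (suc m) α β                    ≡⟨ agreeingSubsets≡binomial k α β (suc m) ⟩
    (k ∸ hamming α β) C suc m                        ∎
  ... | yes a≡b = begin
    agreeingSubsets (suc k) (suc m) (a ∷ α) (b ∷ β)      ≡⟨ agreeingSubsets-∷-≡ {α = α} {β} a≡b m ⟩
    agreeingSubsets k (suc m) α β + agreeingSubsets k m α β
      ≡⟨ cong₂ _+_ (agreeingSubsets≡binomial k α β (suc m)) (agreeingSubsets≡binomial k α β m) ⟩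
    (k ∸ d) C suc m + (k ∸ d) C m                        ≡⟨ +-comm ((k ∸ d) C suc m) _ ⟩
    (k ∸ d) C m + (k ∸ d) C suc m                        ≡⟨ nCk+nC[k+1]≡[n+1]C[k+1] (k ∸ d) m ⟩
    suc (k ∸ d) C suc m                                  ≡⟨ cong (_C suc m) (+-∸-assoc 1 (hamming≤length α β)) ⟨
    (suc k ∸ d) C suc m                                  ∎
    where
    d = hamming α β

module _ {s k : ℕ} (SX SY : List (KMer s k)) where

  binomial-at : ℕ → KMer s k × KMer s k → ℕ
  binomial-at i p = (k ∸ uncurry hamming p) C (k ∸ i)

  M≡sum-δ : ∀ j → M SX SY j ≡ sum (map (λ p → δ (uncurry hamming p) j) (pairs SX SY))
  M≡sum-δ j = length-filter≡sum-indicator (λ p → uncurry hamming p ≟ j) (pairs SX SY)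

  M+correction≡sum-binomial : ∀ i → M SX SY i + correction SX SY i ≡ sum (map (binomial-at i) (pairs SX SY))
  M+correction≡sum-binomial i = begin
    M SX SY i + sum (map (λ j → coeff j * M SX SY j) (upTo i))
      ≡⟨ cong₂ _+_ (M≡sum-δ i) (sum-map-cong (λ j → trans (cong (coeff j *_) (M≡sum-δ j)) (*-distribˡ-sum (coeff j) (δ-at j) ps)) (upTo i)) ⟩
    sum (map (δ-at i) ps) + sum (map (λ j → sum (map (λ p → coeff j * δ-at j p) ps)) (upTo i))
      ≡⟨ cong (sum (map (δ-at i) ps) +_) (sum-map-swap (λ j p → coeff j * δ-at j p) (upTo i) ps) ⟩
    sum (map (δ-at i) ps) + sum (map (λ p → sum (map (λ j → coeff j * δ-at j p) (upTo i))) ps)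
      ≡⟨ sum-map-+ (δ-at i) (λ p → sum (map (λ j → coeff j * δ-at j p) (upTo i))) ps ⟨
    sum (map (λ p → δ-at i p + sum (map (λ j → coeff j * δ-at j p) (upTo i))) ps)
      ≡⟨ sum-map-cong (λ p → δ+sum-upTo≡binomial k (uncurry hamming p) i (uncurry hamming≤length p)) ps ⟩
    sum (map (binomial-at i) ps) ∎
    where
    ps = pairs SX SY
    coeff : ℕ → ℕ
    coeff j = (k ∸ j) C (k ∸ i)
    δ-at : ℕ → KMer s k × KMer s k → ℕ
    δ-at j p = δ (uncurry hamming p) j

  F≡sum-binomial : ∀ i → F i SX SY ≡ sum (map (binomial-at i) (pairs SX SY))
  F≡sum-binomial i = begin
    sum (map (λ θ → f θ SX SY) (Q k (k ∸ i)))
      ≡⟨ sum-map-filter (λ θ → ∣ θ ∣ ≟ k ∸ i) (λ θ → f θ SX SY) (allSubsets k) ⟩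
    sum (map (λ θ → hasSize θ * f θ SX SY) (allSubsets k))
      ≡⟨ sum-map-cong (λ θ → trans (cong (hasSize θ *_) (f≡sum θ)) (*-distribˡ-sum (hasSize θ) (agreesOn-at θ) ps)) (allSubsets k) ⟩
    sum (map (λ θ → sum (map (λ p → hasSize θ * agreesOn-at θ p) ps)) (allSubsets k))
      ≡⟨ sum-map-swap (λ θ p → hasSize θ * agreesOn-at θ p) (allSubsets k) ps ⟩
    sum (map (λ p → agreeingSubsets k (k ∸ i) (proj₁ p) (proj₂ p)) ps)
      ≡⟨ sum-map-cong (λ p → agreeingSubsets≡binomial k (proj₁ p) (proj₂ p) (k ∸ i)) ps ⟩
    sum (map (binomial-at i) ps) ∎
    where
    ps = pairs SX SY
    hasSize : Subset k → ℕ
    hasSize θ = indicator (does (∣ θ ∣ ≟ k ∸ i))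
    agreesOn-at : Subset k → KMer s k × KMer s k → ℕ
    agreesOn-at θ p = agreesOn θ (proj₁ p) (proj₂ p)
    f≡sum : ∀ θ → f θ SX SY ≡ sum (map (agreesOn-at θ) ps)
    f≡sum θ = length-filter≡sum-indicator (λ p → ListP.≡-dec FinP._≟_ (restrict θ (proj₁ p)) (restrict θ (proj₂ p))) ps

-- The identity holds for arbitrary lists (with repetitions) and every i.
corollary8 : (s k : ℕ) → k ≥ 1 → (SX SY : List (KMer s k)) → Unique SX → Unique SY →
    (i : ℕ) → i ≤ k →
    M SX SY i + correction SX SY i ≡ F i SX SY
corollary8 s k _ SX SY _ _ i _ = trans (M+correction≡sum-binomial SX SY i) (sym (F≡sum-binomial SX SY i))
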